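{- Let $b>2$ be an integer with prime factorization $b=p_1^{a_1}\cdots p_s^{a_s}$ ($p_1,\dots,p_s$ distinct primes, $a_i\ge1$). If there exists an integer $a$ coprime to $b$ such that $\ell_b(n!)=a$ for infinitely many positive integers $n$, then $$a_1(p_1-1)=a_2(p_2-1)=\cdots=a_s(p_s-1).$$
   Context: For an integer $b\ge2$ and a positive integer $m$, write $m=b^{v}m'$ with $b\nmid m'$; $\ell_b(m)\in\{1,\dots,b-1\}$ denotes the last nonzero digit of $m$ in base $b$, i.e. the residue of $m'$ modulo $b$. -}

module Defs where

open import Data.Nat using (ℕ; _*_; _^_; _%_; NonZero)
open import Data.Nat.Divisibility using (_∣_)
open import Data.Product using (∃₂; _×_)
open import Relation.Binary.PropositionalEquality using (_≡_)
open import Relation.Nullary using (¬_)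

-- LastNonzeroDigit b m d  :  ℓ_b(m) = d,  i.e. m = b^v * m' with b ∤ m'
-- and d is the residue of m' modulo b.  (The decomposition is unique
-- for m > 0 and b ≥ 2, so this relation is functional.)
LastNonzeroDigit : (b : ℕ) .{{_ : NonZero b}} → ℕ → ℕ → Set
LastNonzeroDigit b m d =
  ∃₂ λ v m′ → (m ≡ b ^ v * m′) × (¬ (b ∣ m′)) × (m′ % b ≡ d)

-- Write n! = b^v m′ with b ∤ m′ and m′ ≡ a (mod b). Since a is prime to b, no prime p ∣ b
-- divides m′, so p^i ∥ b gives v_p(n!) = i v, with the same v for every prime factor of b.
-- Legendre's formula v_p(n!) (p - 1) = n - s_p(n), where s_p is the base-p digit sum, turns
-- this into i (p - 1) v = n - s_p(n). If i (p - 1) < j (q - 1) for two prime factors, then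
-- v ≤ s_p(n) and hence n ≤ j (q - 1) s_p(n) + s_q(n); as digit sums are o(n), n is bounded.

module Submission where

open import Defs
open import Data.Nat using (ℕ; suc; _*_; _^_; _∸_; _<_; _≤_; NonZero; _!)
open import Data.Nat.Coprimality using (Coprime)
open import Data.Nat.Divisibility using (_∣_)
open import Data.Nat.Primality using (Prime)
open import Data.Product using (∃; _×_)
open import Relation.Binary.PropositionalEquality using (_≡_)
open import Relation.Nullary using (¬_)

open import Data.Nat using (zero; _+_; _/_; _%_; s≤s; _≤?_; z≤n; >-nonZero; nonTrivial⇒n>1)
open import Data.Nat.Properties
open import Data.Nat.DivMod using (m≡m%n+[m/n]*n; m%n<n; m/n<m)
open import Data.Nat.Divisibility
  using (divides; ∣1⇒≡1; ∣m+n∣m⇒∣n; ∣⇒≤; ∣-trans; m∣m*n; ∣m⇒∣m*n; %-presˡ-∣)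
open import Data.Nat.Primality using (euclidsLemma; ¬prime[1]; prime⇒nonZero; prime⇒nonTrivial)
open import Data.Nat.Induction using (<-rec)
open import Data.Nat.Tactic.RingSolver using (solve-∀)
open import Data.Product using (_,_)
open import Data.Sum using (inj₁; inj₂)
open import Data.Empty using (⊥-elim)
open import Relation.Nullary using (yes; no)
open import Relation.Binary using (tri<; tri≈; tri>)
open import Relation.Binary.PropositionalEquality using (refl; sym; trans; cong; cong₂; subst; module ≡-Reasoning)

private
  variable
    p m n e f s t : ℕ

prime∤1 : Prime p → ¬ p ∣ 1
prime∤1 pp p∣1 = ¬prime[1] (subst Prime (∣1⇒≡1 p∣1) pp)

prime∤* : Prime p → ¬ p ∣ m → ¬ p ∣ n → ¬ p ∣ m * n
prime∤* {m = m} {n} pp p∤m p∤n p∣mn with euclidsLemma m n pp p∣mn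
... | inj₁ p∣m = p∤m p∣m
... | inj₂ p∣n = p∤n p∣n

record Valuation (p m e : ℕ) : Set where
  constructor valuation
  field
    cofactor      : ℕ
    decomposition : m ≡ p ^ e * cofactor
    p∤cofactor    : ¬ p ∣ cofactor

valuation-unit : ¬ p ∣ m → Valuation p m 0
valuation-unit {m = m} p∤m = valuation m (sym (*-identityˡ m)) p∤m

valuation-prime^ : Prime p → ∀ e → Valuation p (p ^ e) e
valuation-prime^ {p} pp e = valuation 1 (sym (*-identityʳ (p ^ e))) (prime∤1 pp)

valuation-exact : p ^ e ∣ m → ¬ p ^ suc e ∣ m → Valuation p m e
valuation-exact {p} {e} (divides c refl) p^1+e∤m =
  valuation c (*-comm c (p ^ e)) λ { (divides d refl) → p^1+e∤m (divides d (*-assoc d p (p ^ e))) }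

valuation-unique : .{{NonZero p}} → Valuation p m e → Valuation p m f → e ≡ f
valuation-unique {e = zero} {zero} _ _ = refl
valuation-unique {p} {e = zero} {suc f} (valuation u refl p∤u) (valuation w eq _) =
  ⊥-elim (p∤u (subst (p ∣_) (trans (sym eq) (*-identityˡ u)) (∣m⇒∣m*n w (m∣m*n (p ^ f)))))
valuation-unique {p} {e = suc e} {zero} (valuation u refl _) (valuation w eq p∤w) =
  ⊥-elim (p∤w (subst (p ∣_) (trans eq (*-identityˡ w)) (∣m⇒∣m*n u (m∣m*n (p ^ e)))))
valuation-unique {p} {e = suc e} {suc f} (valuation u refl p∤u) (valuation w eq p∤w) =
  cong suc (valuation-unique (valuation u refl p∤u) (valuation w cancel p∤w))
  where
  cancel : p ^ e * u ≡ p ^ f * w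
  cancel = *-cancelˡ-≡ _ _ p (trans (sym (*-assoc p (p ^ e) u)) (trans eq (*-assoc p (p ^ f) w)))

valuation-* : Prime p → Valuation p m e → Valuation p n f → Valuation p (m * n) (e + f)
valuation-* {p} {e = e} {f = f} pp (valuation u refl p∤u) (valuation w refl p∤w) =
  valuation (u * w) eq (prime∤* pp p∤u p∤w)
  where
  eq : p ^ e * u * (p ^ f * w) ≡ p ^ (e + f) * (u * w)
  eq = begin
    p ^ e * u * (p ^ f * w)   ≡⟨ rearrange (p ^ e) (p ^ f) u w ⟩
    p ^ e * p ^ f * (u * w)   ≡⟨ cong (_* (u * w)) (^-distribˡ-+-* p e f) ⟨
    p ^ (e + f) * (u * w)     ∎
    where
    open ≡-Reasoning
    rearrange : ∀ x y u w → x * u * (y * w) ≡ x * y * (u * w)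
    rearrange = solve-∀

valuation-^ : Prime p → Valuation p m e → ∀ v → Valuation p (m ^ v) (v * e)
valuation-^ pp _   zero    = valuation-unit (prime∤1 pp)
valuation-^ pp val (suc v) = valuation-* pp val (valuation-^ pp val v)

factorial-tail : Prime p → p ∣ m → ∀ r → r < p → ∃ λ u → ¬ p ∣ u × (r + m) ! ≡ u * m !
factorial-tail {m = m} pp p∣m zero    _     = 1 , prime∤1 pp , sym (*-identityˡ (m !))
factorial-tail {p} {m} pp p∣m (suc r) 1+r<p with factorial-tail pp p∣m r (<-trans (n<1+n r) 1+r<p)
... | u , p∤u , eq = suc (r + m) * u , prime∤* pp p∤1+r+m p∤u , step
  where
  p∤1+r+m : ¬ p ∣ suc r + m
  p∤1+r+m p∣ = <⇒≱ 1+r<p (∣⇒≤ (∣m+n∣m⇒∣n (subst (p ∣_) (+-comm (suc r) m) p∣) p∣m))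
  step : suc (r + m) * (r + m) ! ≡ suc (r + m) * u * m !
  step = trans (cong (suc (r + m) *_) eq) (sym (*-assoc (suc (r + m)) u (m !)))

factorial-multiple : Prime p → ∀ q → ∃ λ u → ¬ p ∣ u × (p * q) ! ≡ u * (p ^ q * q !)
factorial-multiple {p} pp zero rewrite *-zeroʳ p = 1 , prime∤1 pp , refl
factorial-multiple {p@(suc k)} pp (suc q)
  with factorial-multiple pp q | factorial-tail pp (m∣m*n q) k ≤-refl
... | u , p∤u , eq | w , p∤w , eq′ = w * u , prime∤* pp p∤w p∤u , step
  where
  open ≡-Reasoning
  rearrange : ∀ p s w u P F → p * s * (w * (u * (P * F))) ≡ w * u * (p * P * (s * F))
  rearrange = solve-∀
  step : (p * suc q) ! ≡ w * u * (p ^ suc q * suc q !)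
  step = begin
    (p * suc q) !                                  ≡⟨ cong _! (*-suc p q) ⟩
    (p + p * q) * (k + p * q) !                    ≡⟨ cong₂ _*_ (sym (*-suc p q)) eq′ ⟩
    p * suc q * (w * (p * q) !)                    ≡⟨ cong (λ x → p * suc q * (w * x)) eq ⟩
    p * suc q * (w * (u * (p ^ q * q !)))          ≡⟨ rearrange p (suc q) w u (p ^ q) (q !) ⟩
    w * u * (p ^ suc q * suc q !)                  ∎

-- DigitSum p n s: s is the sum of the base-p digits of n, read off from the last digit.
-- Leading zero digits are permitted; they do not change the sum.
data DigitSum (p : ℕ) : ℕ → ℕ → Set where
  no-digits : DigitSum p 0 0
  digit     : ∀ {r q s} → r < p → DigitSum p q s → DigitSum p (r + p * q) (r + s)

digitSum-exists : 1 < p → ∀ n → ∃ (DigitSum p n)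
digitSum-exists {p} 1<p = <-rec (λ n → ∃ (DigitSum p n)) expand
  where
  instance
    p≢0 : NonZero p
    p≢0 = >-nonZero (<-trans (s≤s z≤n) 1<p)
  expand : ∀ n → (∀ {m} → m < n → ∃ (DigitSum p m)) → ∃ (DigitSum p n)
  expand zero      _   = 0 , no-digits
  expand n@(suc _) rec with rec (m/n<m n p 1<p)
  ... | s , ds = n % p + s , subst (λ x → DigitSum p x (n % p + s)) (sym n≡r+pq) (digit (m%n<n n p) ds)
    where
    n≡r+pq : n ≡ n % p + p * (n / p)
    n≡r+pq = trans (m≡m%n+[m/n]*n n p) (cong (n % p +_) (*-comm (n / p) p))

digitSum-≤ : DigitSum p n s → s ≤ n
digitSum-≤ no-digits = z≤n
digitSum-≤ {p} (digit {r} {q} r<p ds) =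
  +-monoʳ-≤ r (≤-trans (digitSum-≤ ds) (m≤n*m q p {{>-nonZero (≤-<-trans z≤n r<p)}}))

-- s ≤ n / K + p K for every K, i.e. digit sums are o(n).
digitSum-sublinear : DigitSum p n s → ∀ K → K * s ≤ n + K * (p * K)
digitSum-sublinear no-digits K = ≤-trans (≤-reflexive (*-zeroʳ K)) z≤n
digitSum-sublinear {zero} (digit () _) _
digitSum-sublinear {p@(suc k)} (digit {r} {q} {s} r<p@(s≤s r≤k) ds) K with K ≤? q
... | yes K≤q = begin
  K * (r + s)          ≡⟨ *-distribˡ-+ K r s ⟩
  K * r + K * s        ≤⟨ +-mono-≤ (*-mono-≤ K≤q r≤k) (digitSum-sublinear ds K) ⟩
  q * k + (q + C)      ≡⟨ rearrange q k C ⟩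
  p * q + C            ≤⟨ +-monoˡ-≤ C (m≤n+m (p * q) r) ⟩
  r + p * q + C        ∎
  where
  open ≤-Reasoning
  C = K * (p * K)
  rearrange : ∀ q k C → q * k + (q + C) ≡ suc k * q + C
  rearrange = solve-∀
... | no K≰q = begin
  K * (r + s)          ≤⟨ *-monoʳ-≤ K (digitSum-≤ (digit r<p ds)) ⟩
  K * (r + p * q)      ≤⟨ *-monoʳ-≤ K n≤pK ⟩
  K * (p * K)          ≤⟨ m≤n+m (K * (p * K)) (r + p * q) ⟩
  r + p * q + K * (p * K) ∎
  where
  open ≤-Reasoning
  n≤pK : r + p * q ≤ p * K
  n≤pK = begin
    r + p * q          ≤⟨ +-monoˡ-≤ (p * q) (m≤n⇒m≤1+n r≤k) ⟩
    p + p * q          ≡⟨ *-suc p q ⟨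
    p * suc q          ≤⟨ *-monoʳ-≤ p (≰⇒> K≰q) ⟩
    p * K              ∎

legendre-exponent : ∀ k {q e s} r → e * k + s ≡ q → (q + e) * k + (r + s) ≡ r + suc k * q
legendre-exponent k {e = e} {s} r refl = rearrange k e s r
  where
  rearrange : ∀ k e s r → (e * k + s + e) * k + (r + s) ≡ r + suc k * (e * k + s)
  rearrange = solve-∀

factorial-valuation : Prime p → DigitSum p n s → ∃ λ e → Valuation p (n !) e × e * (p ∸ 1) + s ≡ n
factorial-valuation pp no-digits = 0 , valuation-unit (prime∤1 pp) , refl
factorial-valuation {zero} pp (digit () _)
factorial-valuation {p@(suc k)} pp (digit {r} {q} {s} r<p ds) with factorial-valuation pp ds
... | e , val , e[p-1]+s≡q
  with factorial-multiple pp q | factorial-tail pp (m∣m*n q) r r<p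
... | u , p∤u , eq | w , p∤w , eq′ = q + e , val′ , exponent
  where
  val′ : Valuation p ((r + p * q) !) (q + e)
  val′ = subst (λ x → Valuation p x (q + e)) (sym eq′)
    (valuation-* pp (valuation-unit p∤w)
      (subst (λ x → Valuation p x (q + e)) (sym eq)
        (valuation-* pp (valuation-unit p∤u)
          (valuation-* pp (valuation-prime^ pp q) val))))
  exponent : (q + e) * k + (r + s) ≡ r + p * q
  exponent = legendre-exponent k r e[p-1]+s≡q

legendre-formula : Prime p → Valuation p (n !) e → DigitSum p n s → e * (p ∸ 1) + s ≡ n
legendre-formula pp val ds with factorial-valuation pp ds
... | _ , val′ , eq rewrite valuation-unique {{prime⇒nonZero pp}} val val′ = eq

coprime-residue⇒∤ : ∀ {a b} .{{_ : NonZero b}} → Prime p → Coprime a b → p ∣ b → m % b ≡ a → ¬ p ∣ m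
coprime-residue⇒∤ pp cop p∣b refl p∣m = ¬prime[1] (subst Prime (cop (%-presˡ-∣ p∣m p∣b , p∣b)) pp)

valuation-lastNonzeroBlock : ∀ {a b i} .{{_ : NonZero b}} → Prime p → Coprime a b →
  1 ≤ i → p ^ i ∣ b → ¬ p ^ suc i ∣ b → m % b ≡ a → ∀ v → Valuation p (b ^ v * m) (v * i)
valuation-lastNonzeroBlock {p} {b = b} {suc i} pp cop _ p^i∣b p^1+i∤b m%b≡a v =
  subst (Valuation p (b ^ v * _)) (+-identityʳ (v * suc i))
    (valuation-* pp (valuation-^ pp (valuation-exact p^i∣b p^1+i∤b) v)
                    (valuation-unit (coprime-residue⇒∤ pp cop p∣b m%b≡a)))
  where
  p∣b : p ∣ b
  p∣b = ∣-trans (m∣m*n (p ^ i)) p^i∣b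

digitSums-cover : ∀ {v A B} → A < B → v * A + s ≡ n → v * B + t ≡ n → n ≤ B * s + t
digitSums-cover {s} {n} {t} {v} {A} {B} A<B vA+s≡n vB+t≡n = begin
  n              ≡⟨ vB+t≡n ⟨
  v * B + t      ≤⟨ +-monoˡ-≤ t (*-monoˡ-≤ B v≤s) ⟩
  s * B + t      ≡⟨ cong (_+ t) (*-comm s B) ⟩
  B * s + t      ∎
  where
  open ≤-Reasoning
  v≤s : v ≤ s
  v≤s = +-cancelʳ-≤ (v * A) v s (begin
    v + v * A    ≡⟨ *-suc v A ⟨
    v * suc A    ≤⟨ *-monoʳ-≤ v A<B ⟩
    v * B        ≤⟨ m≤m+n (v * B) t ⟩
    v * B + t    ≡⟨ trans vB+t≡n (sym vA+s≡n) ⟩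
    v * A + s    ≡⟨ +-comm (v * A) s ⟩
    s + v * A    ∎)

≤-from-tripled : ∀ {B x y} → n ≤ B * s + t → 3 * B * s ≤ n + x → 3 * t ≤ n + y → n ≤ x + y
≤-from-tripled {n} {s} {t} {B} {x} {y} n≤Bs+t 3Bs≤ 3t≤ = +-cancelʳ-≤ (n + n) n (x + y) (begin
  n + (n + n)              ≡⟨ cong (λ z → n + (n + z)) (+-identityʳ n) ⟨
  3 * n                    ≤⟨ *-monoʳ-≤ 3 n≤Bs+t ⟩
  3 * (B * s + t)          ≡⟨ distribute B s t ⟩
  3 * B * s + 3 * t        ≤⟨ +-mono-≤ 3Bs≤ 3t≤ ⟩
  (n + x) + (n + y)        ≡⟨ regroup n x y ⟩
  (x + y) + (n + n)        ∎)
  where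
  open ≤-Reasoning
  distribute : ∀ B s t → 3 * (B * s + t) ≡ 3 * B * s + 3 * t
  distribute = solve-∀
  regroup : ∀ n x y → (n + x) + (n + y) ≡ (x + y) + (n + n)
  regroup = solve-∀

prime>1 : Prime p → 1 < p
prime>1 {p} pp = nonTrivial⇒n>1 p {{prime⇒nonTrivial pp}}

lastNonzeroDigit-factorial-bounded : ∀ {a b q i j} .{{_ : NonZero b}} → Coprime a b → Prime p → Prime q →
  1 ≤ i → p ^ i ∣ b → ¬ p ^ suc i ∣ b → 1 ≤ j → q ^ j ∣ b → ¬ q ^ suc j ∣ b →
  i * (p ∸ 1) < j * (q ∸ 1) → ∃ λ C → ∀ n → LastNonzeroDigit b (n !) a → n ≤ C
lastNonzeroDigit-factorial-bounded {p} {b = b} {q} {i} {j} cop pp pq 1≤i p^i∣b p^1+i∤b 1≤j q^j∣b q^1+j∤b A<B =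
  K * (p * K) + 3 * (q * 3) , bounded
  where
  -- n ≤ B s + t with B = j(q - 1), so weights 3B and 3 make the digit sums account for at most 2n / 3.
  K = 3 * (j * (q ∸ 1))
  bounded : ∀ n → LastNonzeroDigit b (n !) _ → n ≤ K * (p * K) + 3 * (q * 3)
  bounded n (v , m , n!≡b^v*m , _ , m%b≡a)
    with digitSum-exists (prime>1 pp) n | digitSum-exists (prime>1 pq) n
  ... | s , ds | t , dt = ≤-from-tripled {s = s} {t} {j * (q ∸ 1)}
          (digitSums-cover {v = v} A<B (weighted pp 1≤i p^i∣b p^1+i∤b ds) (weighted pq 1≤j q^j∣b q^1+j∤b dt))
          (digitSum-sublinear ds K) (digitSum-sublinear dt 3)
    where
    weighted : ∀ {p i s} → Prime p → 1 ≤ i → p ^ i ∣ b → ¬ p ^ suc i ∣ b → DigitSum p n s →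
      v * (i * (p ∸ 1)) + s ≡ n
    weighted {p} {i} {s} pp 1≤i p^i∣b p^1+i∤b ds =
      trans (cong (_+ s) (sym (*-assoc v i (p ∸ 1))))
        (legendre-formula pp
          (subst (λ x → Valuation p x (v * i)) (sym n!≡b^v*m)
            (valuation-lastNonzeroBlock pp cop 1≤i p^i∣b p^1+i∤b m%b≡a v))
          ds)

unbounded⇒¬bounded : ∀ {P : ℕ → Set} → (∀ N → ∃ λ n → N < n × P n) → ¬ ∃ λ C → ∀ n → P n → n ≤ C
unbounded⇒¬bounded unbounded (C , bounded) with unbounded C
... | n , C<n , Pn = <⇒≱ C<n (bounded n Pn)

claim5p2 : (b : ℕ) .{{_ : NonZero b}} → 2 < b → (a : ℕ) → Coprime a b →
    (∀ N → ∃ λ n → N < n × LastNonzeroDigit b (n !) a) →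
    ∀ p q i j → Prime p → Prime q →
    1 ≤ i → p ^ i ∣ b → ¬ (p ^ suc i ∣ b) →
    1 ≤ j → q ^ j ∣ b → ¬ (q ^ suc j ∣ b) →
    i * (p ∸ 1) ≡ j * (q ∸ 1)
claim5p2 b _ a cop unbounded p q i j pp pq 1≤i p^i∣b p^1+i∤b 1≤j q^j∣b q^1+j∤b
  with <-cmp (i * (p ∸ 1)) (j * (q ∸ 1))
... | tri< lt _ _ = ⊥-elim (unbounded⇒¬bounded unbounded
        (lastNonzeroDigit-factorial-bounded cop pp pq 1≤i p^i∣b p^1+i∤b 1≤j q^j∣b q^1+j∤b lt))
... | tri≈ _ eq _ = eq
... | tri> _ _ gt = ⊥-elim (unbounded⇒¬bounded unbounded
        (lastNonzeroDigit-factorial-bounded cop pq pp 1≤j q^j∣b q^1+j∤b 1≤i p^i∣b p^1+i∤b gt))
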